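{- For every $n\ge 1$, the triple of statistics $(\mathrm{jump},\mathrm{des},\mathrm{lsuc})$ and the triple $(\mathrm{exc},\mathrm{drop},\mathrm{fix})$ are equidistributed over $S_n$, i.e. $$\sum_{\sigma\in S_n} x^{\mathrm{jump}(\sigma)} y^{\mathrm{des}(\sigma)} z^{\mathrm{lsuc}(\sigma)}=\sum_{\sigma\in S_n} x^{\mathrm{exc}(\sigma)} y^{\mathrm{drop}(\sigma)} z^{\mathrm{fix}(\sigma)}.$$
   Context: $S_n$ is the set of permutations $\sigma=\sigma_1\cdots\sigma_n$ of $[n]$, with the convention $\sigma_0=0$. $\mathrm{des}(\sigma)$ is the number of indices $1\le i\le n-1$ with $\sigma_i>\sigma_{i+1}$; $\mathrm{lsuc}(\sigma)$ is the number of indices $1\le i\le n$ with $\sigma_{i-1}+1=\sigma_i$ (left successions); $\mathrm{jump}(\sigma)$ is the number of indices $1\le i\le n$ with $\sigma_i\ge\sigma_{i-1}+2$. $\mathrm{exc}(\sigma)$, $\mathrm{drop}(\sigma)$, $\mathrm{fix}(\sigma)$ are the numbers of indices $1\le i\le n$ with $\sigma_i>i$, $\sigma_i<i$, $\sigma_i=i$ respectively. -}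

module Defs where

open import Data.Nat using (ℕ; zero; suc; _+_; _<ᵇ_; _≡ᵇ_)
open import Data.Bool using (Bool; true; false; if_then_else_; _∧_)
open import Data.List using (List; []; _∷_; concatMap; length; filter; map)
open import Data.Product using (_×_; _,_)
open import Relation.Binary.PropositionalEquality using (_≡_)
open import Relation.Nullary.Decidable using (_×-dec_)
import Data.Nat as ℕ

-- A permutation σ = σ₁ ⋯ σₙ of [n] = {1,…,n} in one-line notation,
-- represented as the list [σ₁, …, σₙ] of natural numbers.

insertions : ℕ → List ℕ → List (List ℕ)
insertions x []       = (x ∷ []) ∷ []
insertions x (y ∷ ys) = (x ∷ y ∷ ys) ∷ map (y ∷_) (insertions x ys)

S : ℕ → List (List ℕ)
S zero    = [] ∷ []
S (suc n) = concatMap (insertions (suc n)) (S n)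

[_] : Bool → ℕ
[ true ]  = 1
[ false ] = 0

des : List ℕ → ℕ
des []            = 0
des (a ∷ [])      = 0
des (a ∷ b ∷ xs)  = [ b <ᵇ a ] + des (b ∷ xs)

lsucFrom : ℕ → List ℕ → ℕ
lsucFrom p []       = 0
lsucFrom p (a ∷ xs) = [ suc p ≡ᵇ a ] + lsucFrom a xs

jumpFrom : ℕ → List ℕ → ℕ
jumpFrom p []       = 0
jumpFrom p (a ∷ xs) = [ suc p <ᵇ a ] + jumpFrom a xs

lsuc : List ℕ → ℕ
lsuc = lsucFrom 0

jump : List ℕ → ℕ
jump = jumpFrom 0

excFrom dropFrom fixFrom : ℕ → List ℕ → ℕ
excFrom i []       = 0
excFrom i (a ∷ xs) = [ i <ᵇ a ] + excFrom (suc i) xs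
dropFrom i []       = 0
dropFrom i (a ∷ xs) = [ a <ᵇ i ] + dropFrom (suc i) xs
fixFrom i []       = 0
fixFrom i (a ∷ xs) = [ a ≡ᵇ i ] + fixFrom (suc i) xs

exc drop fix : List ℕ → ℕ
exc  = excFrom 1
drop = dropFrom 1
fix  = fixFrom 1

Triple : Set
Triple = ℕ × ℕ × ℕ

jdl : List ℕ → Triple
jdl σ = jump σ , des σ , lsuc σ

edf : List ℕ → Triple
edf σ = exc σ , drop σ , fix σ

_≡³_ : Triple → Triple → Bool
(a , b , c) ≡³ (a' , b' , c') = (a ≡ᵇ a') ∧ (b ≡ᵇ b') ∧ (c ≡ᵇ c')

-- number of σ ∈ S_n whose statistic triple equals t, i.e. the coefficient
-- of x^a y^b z^c (t = (a,b,c)) in  Σ_{σ ∈ S_n} x^{st₁ σ} y^{st₂ σ} z^{st₃ σ}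
coeff : (List ℕ → Triple) → ℕ → Triple → ℕ
coeff st n t = length (filter (λ σ → Data.Bool.T? (st σ ≡³ t)) (S n))

module Submission where

-- Encode a permutation by the word over {J, D, L} of the kinds of its adjacent pairs
-- σ_{i-1} σ_i (jump, descent, left succession), or of its positions i (excedance, drop,
-- fixed point); each statistic triple is the tally of the corresponding word.  In both
-- encodings, building S (n + 1) from S n sends a permutation with tally t to n + 1
-- permutations, whose tallies are t with one more L and, for each letter of the word,
-- t with that letter replaced by J D.  So both multisets of triples obey the same recursion.

open import Defs
open import Data.Nat using (ℕ; zero; suc; _+_; _∸_; _≤_; _<_; _<ᵇ_; _≡ᵇ_; z≤n; s≤s)
open import Data.Nat.Properties using (+-identityʳ; +-suc; ≤-refl; ≤-trans; ≤-pred; <⇒≤; ≤∧≢⇒<; m≤n⇒m≤1+n; n≮n; _≟_)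
open import Data.Bool using (true; false; if_then_else_; T?)
open import Data.List using (List; []; _∷_; _++_; _∷ʳ_; map; concat; concatMap; length; filter; replicate; upTo; applyUpTo; initLast; _∷ʳ′_)
open import Data.List.Properties using (map-++; map-∘; map-cong; map-cong-local; map-replicate; ++-assoc; ∷-injective; ∷-injectiveʳ; map-concatMap; concatMap-map; map-applyUpTo)
open import Data.Product using (_×_; _,_; proj₁; proj₂)
open import Data.Empty using (⊥-elim)
open import Function using (_∘_)
open import Function.Bundles using (mk⇔)
open import Relation.Nullary using (¬_; yes; no)
open import Data.List.Relation.Unary.All as All using (All; []; _∷_)
open import Data.List.Relation.Unary.Any using (here; there)
open import Data.List.Membership.Propositional using (_∈_; _∉_; find; lose)
open import Data.List.Membership.Propositional.Properties using (∈-map⁺; ∈-map⁻; ∈-∃++; ∈-concatMap⁺; ∈-concatMap⁻; ∈-upTo⁻)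
open import Data.List.Membership.Propositional.Properties.WithK using (unique∧set⇒bag)
open import Data.List.Relation.Unary.Unique.Propositional using (Unique)
open import Data.List.Relation.Unary.AllPairs using ([]; _∷_)
import Data.List.Relation.Unary.Unique.Propositional.Properties as Unique
open import Data.List.Relation.Binary.Permutation.Propositional using (_↭_; prep; swap; ↭-refl; ↭-trans; ↭-sym; ↭-reflexive; module PermutationReasoning) renaming (refl to ↭-refl′; trans to ↭-trans′)
open import Data.List.Relation.Binary.Permutation.Propositional.Properties using (++⁺ˡ; ++⁺ʳ; ++⁺; shifts; shift; ∷↭∷ʳ; ↭-length; filter-↭; ∈-resp-↭; All-resp-↭; drop-mid; ↭-empty-inv; map⁺)
open import Data.List.Relation.Binary.BagAndSetEquality using (∼bag⇒↭)
open import Relation.Binary.PropositionalEquality using (_≡_; _≢_; ≢-sym; refl; sym; trans; cong; cong₂; subst; module ≡-Reasoning)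

module _ {A B : Set} where

  concatMap⁺ : (f : A → List B) {xs ys : List A} → xs ↭ ys → concatMap f xs ↭ concatMap f ys
  concatMap⁺ f ↭-refl′        = ↭-refl
  concatMap⁺ f (prep x p)     = ++⁺ˡ (f x) (concatMap⁺ f p)
  concatMap⁺ f (swap x y p)   = ↭-trans (++⁺ˡ (f x) (++⁺ˡ (f y) (concatMap⁺ f p))) (shifts (f x) (f y))
  concatMap⁺ f (↭-trans′ p q) = ↭-trans (concatMap⁺ f p) (concatMap⁺ f q)

  concatMap-cong-↭ : {f g : A → List B} (xs : List A) → (∀ {x} → x ∈ xs → f x ↭ g x) →
                     concatMap f xs ↭ concatMap g xs
  concatMap-cong-↭ []       f↭g = ↭-refl
  concatMap-cong-↭ (x ∷ xs) f↭g = ++⁺ (f↭g (here refl)) (concatMap-cong-↭ xs (f↭g ∘ there))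

  concatMap-++-↭ : (f g : A → List B) (xs : List A) →
                   concatMap (λ x → f x ++ g x) xs ↭ concatMap f xs ++ concatMap g xs
  concatMap-++-↭ f g []       = ↭-refl
  concatMap-++-↭ f g (x ∷ xs) = begin
    (f x ++ g x) ++ concatMap (λ x → f x ++ g x) xs   ≡⟨ ++-assoc (f x) (g x) _ ⟩
    f x ++ g x ++ concatMap (λ x → f x ++ g x) xs     ↭⟨ ++⁺ˡ (f x) (++⁺ˡ (g x) (concatMap-++-↭ f g xs)) ⟩
    f x ++ g x ++ concatMap f xs ++ concatMap g xs    ↭⟨ ++⁺ˡ (f x) (shifts (g x) (concatMap f xs)) ⟩
    f x ++ concatMap f xs ++ g x ++ concatMap g xs    ≡⟨ ++-assoc (f x) (concatMap f xs) _ ⟨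
    (f x ++ concatMap f xs) ++ g x ++ concatMap g xs  ∎
    where open PermutationReasoning

Unique-resp-↭ : {A : Set} {xs ys : List A} → xs ↭ ys → Unique xs → Unique ys
Unique-resp-↭ ↭-refl′        u                       = u
Unique-resp-↭ (prep x p)     (x∉ ∷ u)                = All-resp-↭ p x∉ ∷ Unique-resp-↭ p u
Unique-resp-↭ (swap x y p)   ((x≢y ∷ x∉) ∷ y∉ ∷ u) =
  (≢-sym x≢y ∷ All-resp-↭ p y∉) ∷ (All-resp-↭ p x∉ ∷ Unique-resp-↭ p u)
Unique-resp-↭ (↭-trans′ p q) u                       = Unique-resp-↭ q (Unique-resp-↭ p u)

move-to-third : {A : Set} (v : A) (xs ys zs : List A) → v ∷ xs ++ ys ++ zs ↭ xs ++ ys ++ v ∷ zs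
move-to-third v xs ys zs = begin
  v ∷ xs ++ ys ++ zs      ≡⟨ cong (v ∷_) (++-assoc xs ys zs) ⟨
  v ∷ (xs ++ ys) ++ zs    ↭⟨ shift v (xs ++ ys) zs ⟨
  (xs ++ ys) ++ v ∷ zs    ≡⟨ ++-assoc xs ys (v ∷ zs) ⟩
  xs ++ ys ++ v ∷ zs      ∎
  where open PermutationReasoning

Unique-concatMap⁺ : {A B : Set} (f : A → List B) (g : B → A) {xs : List A} → Unique xs →
  (∀ {x} → x ∈ xs → Unique (f x)) → (∀ {x y} → x ∈ xs → y ∈ f x → g y ≡ x) → Unique (concatMap f xs)
Unique-concatMap⁺ f g {[]}     []       _      _     = []
Unique-concatMap⁺ f g {x ∷ xs} (x∉ ∷ u) unique g-inv =
  Unique.++⁺ (unique (here refl)) (Unique-concatMap⁺ f g u (unique ∘ there) (g-inv ∘ there)) disjoint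
  where
  disjoint : ∀ {y} → ¬ (y ∈ f x × y ∈ concatMap f xs)
  disjoint (y∈fx , y∈rest) with x′ , x′∈ , y∈fx′ ← find (∈-concatMap⁻ f y∈rest) =
    All.lookup x∉ x′∈ (trans (sym (g-inv (here refl) y∈fx)) (g-inv (there x′∈) y∈fx′))

concatMap-map-comm : {A B C : Set} (f : A → B → C) (xs : List A) (ys : List B) →
  concatMap (λ x → map (f x) ys) xs ↭ concatMap (λ y → map (λ x → f x y) xs) ys
concatMap-map-comm f []       ys = ↭-reflexive (sym (concatMap-[] ys))
  where
  concatMap-[] : ∀ ys → concatMap (λ y → map (λ x → f x y) []) ys ≡ []
  concatMap-[] []       = refl
  concatMap-[] (y ∷ ys) = concatMap-[] ys
concatMap-map-comm f (x ∷ xs) ys =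
  ↭-trans (++⁺ˡ (map (f x) ys) (concatMap-map-comm f xs ys)) (↭-sym (interleave ys))
  where
  interleave : ∀ ys → concatMap (λ y → f x y ∷ map (λ x → f x y) xs) ys ↭
                      map (f x) ys ++ concatMap (λ y → map (λ x → f x y) xs) ys
  interleave []       = ↭-refl
  interleave (y ∷ ys) = prep (f x y) (↭-trans (++⁺ˡ (map (λ x → f x y) xs) (interleave ys))
                                              (shifts (map (λ x → f x y) xs) (map (f x) ys)))

Unique-map⁺-on : {A B : Set} (f : A → B) {xs : List A} → Unique xs →
  (∀ {x y} → x ∈ xs → y ∈ xs → f x ≡ f y → x ≡ y) → Unique (map f xs)
Unique-map⁺-on f {[]}     []         inj = []
Unique-map⁺-on f {x ∷ xs} (x∉ ∷ u)   inj =
  All.tabulate fx∉ ∷ Unique-map⁺-on f u (λ x∈ y∈ → inj (there x∈) (there y∈))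
  where
  fx∉ : ∀ {v} → v ∈ map f xs → f x ≢ v
  fx∉ v∈ fx≡v with y , y∈ , refl ← ∈-map⁻ f v∈ = All.lookup x∉ y∈ (inj (here refl) (there y∈) fx≡v)

map-↭-bijection : {A : Set} (f g : A → A) (xs : List A) → Unique xs →
  (∀ {x} → x ∈ xs → f x ∈ xs) → (∀ {x} → x ∈ xs → g x ∈ xs) →
  (∀ {x} → x ∈ xs → g (f x) ≡ x) → (∀ {x} → x ∈ xs → f (g x) ≡ x) →
  map f xs ↭ xs
map-↭-bijection f g xs u f∈ g∈ gf fg =
  ∼bag⇒↭ (unique∧set⇒bag (Unique-map⁺-on f u injective) u (mk⇔ to from))
  where
  injective : ∀ {x y} → x ∈ xs → y ∈ xs → f x ≡ f y → x ≡ y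
  injective {x} {y} x∈ y∈ fx≡fy = trans (sym (gf x∈)) (trans (cong g fx≡fy) (gf y∈))
  to : ∀ {y} → y ∈ map f xs → y ∈ xs
  to y∈ with x , x∈ , refl ← ∈-map⁻ f y∈ = f∈ x∈
  from : ∀ {y} → y ∈ xs → y ∈ map f xs
  from y∈ = subst (_∈ map f xs) (fg y∈) (∈-map⁺ f (g∈ y∈))

data Kind : Set where
  J D L : Kind

bump : Kind → Triple → Triple
bump J (j , d , l) = suc j , d , l
bump D (j , d , l) = j , suc d , l
bump L (j , d , l) = j , d , suc l

bump-comm : ∀ x y t → bump x (bump y t) ≡ bump y (bump x t)
bump-comm J J t = refl
bump-comm J D t = refl
bump-comm J L t = refl
bump-comm D J t = refl
bump-comm D D t = refl
bump-comm D L t = refl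
bump-comm L J t = refl
bump-comm L D t = refl
bump-comm L L t = refl

tally : List Kind → Triple
tally []       = 0 , 0 , 0
tally (k ∷ ks) = bump k (tally ks)

tally-↭ : {ks ks′ : List Kind} → ks ↭ ks′ → tally ks ≡ tally ks′
tally-↭ ↭-refl′        = refl
tally-↭ (prep k p)     = cong (bump k) (tally-↭ p)
tally-↭ (swap k k′ p)  = trans (cong (bump k ∘ bump k′) (tally-↭ p)) (bump-comm k k′ _)
tally-↭ (↭-trans′ p q) = trans (tally-↭ p) (tally-↭ q)

tally-∷ʳ : ∀ ks k → tally (ks ∷ʳ k) ≡ bump k (tally ks)
tally-∷ʳ ks k = sym (tally-↭ (∷↭∷ʳ k ks))

map-tally-∷ : ∀ k (kss : List (List Kind)) → map tally (map (k ∷_) kss) ≡ map (bump k) (map tally kss)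
map-tally-∷ k kss = trans (sym (map-∘ kss)) (map-∘ kss)

splits : List Kind → List (List Kind)
splits []       = []
splits (k ∷ ks) = (J ∷ D ∷ ks) ∷ map (k ∷_) (splits ks)

splitTallies : Triple → List Triple
splitTallies (j , d , l) =
  replicate j (j , suc d , l) ++ replicate d (suc j , d , l) ++ replicate l (suc j , suc d , l ∸ 1)

children : Triple → List Triple
children t = bump L t ∷ splitTallies t

map-splitTallies : ∀ (f : Triple → Triple) j d l → map f (splitTallies (j , d , l)) ≡
  replicate j (f (j , suc d , l)) ++ replicate d (f (suc j , d , l)) ++ replicate l (f (suc j , suc d , l ∸ 1))
map-splitTallies f j d l = begin
  map f (replicate j x ++ replicate d y ++ replicate l z)               ≡⟨ map-++ f (replicate j x) _ ⟩
  map f (replicate j x) ++ map f (replicate d y ++ replicate l z)       ≡⟨ cong (map f (replicate j x) ++_) (map-++ f (replicate d y) _) ⟩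
  map f (replicate j x) ++ map f (replicate d y) ++ map f (replicate l z)
    ≡⟨ cong₂ _++_ (map-replicate f j x) (cong₂ _++_ (map-replicate f d y) (map-replicate f l z)) ⟩
  replicate j (f x) ++ replicate d (f y) ++ replicate l (f z)           ∎
  where
  open ≡-Reasoning
  x y z : Triple
  x = j , suc d , l
  y = suc j , d , l
  z = suc j , suc d , l ∸ 1

splitTallies-bump : ∀ t k → bump J (bump D t) ∷ map (bump k) (splitTallies t) ↭ splitTallies (bump k t)
splitTallies-bump t@(j , d , l) J = ↭-reflexive (cong (bump J (bump D t) ∷_) (map-splitTallies (bump J) j d l))
splitTallies-bump t@(j , d , l) D =
  ↭-trans (↭-reflexive (cong (bump J (bump D t) ∷_) (map-splitTallies (bump D) j d l)))
          (↭-sym (shift _ (replicate j (j , suc (suc d) , l)) _))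
splitTallies-bump t@(j , d , zero) L =
  ↭-trans (↭-reflexive (cong (bump J (bump D t) ∷_) (map-splitTallies (bump L) j d 0)))
          (move-to-third _ (replicate j (j , suc d , 1)) _ [])
splitTallies-bump t@(j , d , suc l) L =
  ↭-trans (↭-reflexive (cong (bump J (bump D t) ∷_) (map-splitTallies (bump L) j d (suc l))))
          (move-to-third _ (replicate j (j , suc d , suc (suc l))) _ _)

tally-splits : ∀ ks → map tally (splits ks) ↭ splitTallies (tally ks)
tally-splits []       = ↭-refl
tally-splits (k ∷ ks) = begin
  bump J (bump D (tally ks)) ∷ map tally (map (k ∷_) (splits ks))  ≡⟨ cong (_ ∷_) (map-tally-∷ k (splits ks)) ⟩
  bump J (bump D (tally ks)) ∷ map (bump k) (map tally (splits ks)) ↭⟨ prep _ (map⁺ (bump k) (tally-splits ks)) ⟩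
  bump J (bump D (tally ks)) ∷ map (bump k) (splitTallies (tally ks)) ↭⟨ splitTallies-bump (tally ks) k ⟩
  splitTallies (tally (k ∷ ks))                                     ∎
  where open PermutationReasoning

deleteNth : {A : Set} → ℕ → List A → List A
deleteNth k       []       = []
deleteNth zero    (x ∷ xs) = xs
deleteNth (suc k) (x ∷ xs) = x ∷ deleteNth k xs

splitTally : ℕ → List Kind → Triple
splitTally i ks = bump J (bump D (tally (deleteNth i ks)))

map-tally-splits : ∀ ks → map tally (splits ks) ≡ map (λ i → splitTally i ks) (upTo (length ks))
map-tally-splits []       = refl
map-tally-splits (k ∷ ks) = cong (splitTally 0 (k ∷ ks) ∷_) (begin
  map tally (map (k ∷_) (splits ks))                        ≡⟨ map-tally-∷ k (splits ks) ⟩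
  map (bump k) (map tally (splits ks))                      ≡⟨ cong (map (bump k)) (map-tally-splits ks) ⟩
  map (bump k) (map (λ i → splitTally i ks) (upTo (length ks)))
    ≡⟨ trans (sym (map-∘ (upTo (length ks)))) (map-cong bump-splitTally (upTo (length ks))) ⟩
  map (λ i → splitTally (suc i) (k ∷ ks)) (upTo (length ks))
    ≡⟨ trans (map-applyUpTo _ _ (length ks)) (sym (map-applyUpTo _ _ (length ks))) ⟩
  map (λ i → splitTally i (k ∷ ks)) (applyUpTo suc (length ks)) ∎)
  where
  open ≡-Reasoning
  bump-splitTally : ∀ i → bump k (splitTally i ks) ≡ splitTally (suc i) (k ∷ ks)
  bump-splitTally i = trans (bump-comm k J _) (cong (bump J) (bump-comm k D _))

adjKind : ℕ → ℕ → Kind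
adjKind p a = if suc p ≡ᵇ a then L else (if suc p <ᵇ a then J else D)

adjKinds : ℕ → List ℕ → List Kind
adjKinds p []      = []
adjKinds p (a ∷ σ) = adjKind p a ∷ adjKinds a σ

desFrom : ℕ → List ℕ → ℕ
desFrom p []      = 0
desFrom p (a ∷ σ) = [ a <ᵇ p ] + desFrom a σ

des-desFrom : ∀ σ → des σ ≡ desFrom 0 σ
des-desFrom []          = refl
des-desFrom (a ∷ [])    = refl
des-desFrom (a ∷ b ∷ σ) = cong ([ b <ᵇ a ] +_) (des-desFrom (b ∷ σ))

bump-adjKind : ∀ p a → p ≢ a → ∀ j d l →
  bump (adjKind p a) (j , d , l) ≡ ([ suc p <ᵇ a ] + j , [ a <ᵇ p ] + d , [ suc p ≡ᵇ a ] + l)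
bump-adjKind zero    zero          p≢a = ⊥-elim (p≢a refl)
bump-adjKind zero    (suc zero)    p≢a j d l = refl
bump-adjKind zero    (suc (suc a)) p≢a j d l = refl
bump-adjKind (suc p) zero          p≢a j d l = refl
bump-adjKind (suc p) (suc a)       p≢a = bump-adjKind p a (p≢a ∘ cong suc)

-- adjKind p p = D although p p is no descent, whence the distinctness hypothesis.
adjStatsFrom-tally : ∀ p σ → Unique (p ∷ σ) → (jumpFrom p σ , desFrom p σ , lsucFrom p σ) ≡ tally (adjKinds p σ)
adjStatsFrom-tally p []      u               = refl
adjStatsFrom-tally p (a ∷ σ) ((p≢a ∷ _) ∷ u) =
  trans (sym (bump-adjKind p a p≢a _ _ _)) (cong (bump (adjKind p a)) (adjStatsFrom-tally a σ u))

jdl-tally : ∀ σ → Unique (0 ∷ σ) → jdl σ ≡ tally (adjKinds 0 σ)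
jdl-tally σ u = trans (cong (λ d → jump σ , d , lsuc σ) (des-desFrom σ)) (adjStatsFrom-tally 0 σ u)

adjKind-D : ∀ p a → a ≤ p → adjKind p a ≡ D
adjKind-D p       zero    _         = refl
adjKind-D (suc p) (suc a) (s≤s a≤p) = adjKind-D p a a≤p

adjKind-J : ∀ p a → suc p < a → adjKind p a ≡ J
adjKind-J zero    (suc zero)    (s≤s ())
adjKind-J zero    (suc (suc a)) _         = refl
adjKind-J (suc p) (suc a)       (s≤s p<a) = adjKind-J p a p<a

adjKind-L : ∀ p → adjKind p (suc p) ≡ L
adjKind-L zero    = refl
adjKind-L (suc p) = adjKind-L p

posKind : ℕ → ℕ → Kind
posKind i a = if a ≡ᵇ i then L else (if i <ᵇ a then J else D)

posKinds : ℕ → List ℕ → List Kind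
posKinds i []      = []
posKinds i (a ∷ σ) = posKind i a ∷ posKinds (suc i) σ

bump-posKind : ∀ i a j d l →
  bump (posKind i a) (j , d , l) ≡ ([ i <ᵇ a ] + j , [ a <ᵇ i ] + d , [ a ≡ᵇ i ] + l)
bump-posKind zero    zero    j d l = refl
bump-posKind zero    (suc a) j d l = refl
bump-posKind (suc i) zero    j d l = refl
bump-posKind (suc i) (suc a) j d l = bump-posKind i a j d l

posStatsFrom-tally : ∀ i σ → (excFrom i σ , dropFrom i σ , fixFrom i σ) ≡ tally (posKinds i σ)
posStatsFrom-tally i []      = refl
posStatsFrom-tally i (a ∷ σ) =
  trans (sym (bump-posKind i a _ _ _)) (cong (bump (posKind i a)) (posStatsFrom-tally (suc i) σ))

edf-tally : ∀ σ → edf σ ≡ tally (posKinds 1 σ)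
edf-tally = posStatsFrom-tally 1

posKind-J : ∀ i a → i < a → posKind i a ≡ J
posKind-J zero    (suc a) _         = refl
posKind-J (suc i) (suc a) (s≤s i<a) = posKind-J i a i<a

posKind-D : ∀ i a → a < i → posKind i a ≡ D
posKind-D (suc i) zero    _         = refl
posKind-D (suc i) (suc a) (s≤s a<i) = posKind-D i a a<i

posKind-L : ∀ i → posKind i i ≡ L
posKind-L zero    = refl
posKind-L (suc i) = posKind-L i

descending : ℕ → List ℕ
descending zero    = []
descending (suc n) = suc n ∷ descending n

length-descending : ∀ n → length (descending n) ≡ n
length-descending zero    = refl
length-descending (suc n) = cong suc (length-descending n)

∈-descending⁻ : ∀ n {a} → a ∈ descending n → 1 ≤ a × a ≤ n
∈-descending⁻ (suc n) (here refl) = s≤s z≤n , ≤-refl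
∈-descending⁻ (suc n) (there a∈)  with 1≤a , a≤n ← ∈-descending⁻ n a∈ = 1≤a , m≤n⇒m≤1+n a≤n

Unique-descending : ∀ n → Unique (descending n)
Unique-descending zero    = []
Unique-descending (suc n) = All.tabulate (λ a∈ 1+n≡a → n≮n n (subst (_≤ n) (sym 1+n≡a) (proj₂ (∈-descending⁻ n a∈))))
                          ∷ Unique-descending n

insertions-↭ : ∀ x π {σ} → σ ∈ insertions x π → σ ↭ x ∷ π
insertions-↭ x []       (here refl) = ↭-refl
insertions-↭ x (y ∷ ys) (here refl) = ↭-refl
insertions-↭ x (y ∷ ys) (there σ∈)  with σ′ , σ′∈ , refl ← ∈-map⁻ (y ∷_) σ∈ =
  ↭-trans (prep y (insertions-↭ x ys σ′∈)) (swap y x ↭-refl)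

∈-insertions : ∀ x as bs → as ++ x ∷ bs ∈ insertions x (as ++ bs)
∈-insertions x []       []       = here refl
∈-insertions x []       (b ∷ bs) = here refl
∈-insertions x (a ∷ as) bs       = there (∈-map⁺ (a ∷_) (∈-insertions x as bs))

∈S⇒↭ : ∀ n {σ} → σ ∈ S n → σ ↭ descending n
∈S⇒↭ zero    (here refl) = ↭-refl
∈S⇒↭ (suc n) σ∈          with π , π∈ , σ∈′ ← find (∈-concatMap⁻ (insertions (suc n)) σ∈) =
  ↭-trans (insertions-↭ (suc n) π σ∈′) (prep (suc n) (∈S⇒↭ n π∈))

↭⇒∈S : ∀ n {σ} → σ ↭ descending n → σ ∈ S n
↭⇒∈S zero    σ↭ with refl ← ↭-empty-inv σ↭ = here refl
↭⇒∈S (suc n) σ↭ with as , bs , refl ← ∈-∃++ (∈-resp-↭ (↭-sym σ↭) (here refl)) =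
  ∈-concatMap⁺ (insertions (suc n)) (lose (↭⇒∈S n (drop-mid as [] σ↭)) (∈-insertions (suc n) as bs))

↭descending⇒bounds : ∀ n {σ} → σ ↭ descending n → ∀ {a} → a ∈ σ → 1 ≤ a × a ≤ n
↭descending⇒bounds n σ↭ a∈ = ∈-descending⁻ n (∈-resp-↭ σ↭ a∈)

↭descending⇒Unique-0∷ : ∀ n {σ} → σ ↭ descending n → Unique (0 ∷ σ)
↭descending⇒Unique-0∷ n σ↭ =
  All.tabulate (λ a∈ 0≡a → 1≰0 (subst (1 ≤_) (sym 0≡a) (proj₁ (↭descending⇒bounds n σ↭ a∈))))
  ∷ Unique-resp-↭ (↭-sym σ↭) (Unique-descending n)
  where 1≰0 : ¬ 1 ≤ 0
        1≰0 ()

length-S : ∀ n {σ} → σ ∈ S n → length σ ≡ n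
length-S n σ∈ = trans (↭-length (∈S⇒↭ n σ∈)) (length-descending n)

≡ᵇ-refl : ∀ n → (n ≡ᵇ n) ≡ true
≡ᵇ-refl zero    = refl
≡ᵇ-refl (suc n) = ≡ᵇ-refl n

≢⇒≡ᵇ-false : ∀ m n → m ≢ n → (m ≡ᵇ n) ≡ false
≢⇒≡ᵇ-false zero    zero    m≢n = ⊥-elim (m≢n refl)
≢⇒≡ᵇ-false zero    (suc n) m≢n = refl
≢⇒≡ᵇ-false (suc m) zero    m≢n = refl
≢⇒≡ᵇ-false (suc m) (suc n) m≢n = ≢⇒≡ᵇ-false m n (m≢n ∘ cong suc)

removeFirst : ℕ → List ℕ → List ℕ
removeFirst x []       = []
removeFirst x (y ∷ ys) = if y ≡ᵇ x then ys else y ∷ removeFirst x ys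

removeFirst-insertions : ∀ x π → x ∉ π → ∀ {σ} → σ ∈ insertions x π → removeFirst x σ ≡ π
removeFirst-insertions x []       x∉ (here refl) rewrite ≡ᵇ-refl x = refl
removeFirst-insertions x (y ∷ ys) x∉ (here refl) rewrite ≡ᵇ-refl x = refl
removeFirst-insertions x (y ∷ ys) x∉ (there σ∈)
  with σ′ , σ′∈ , refl ← ∈-map⁻ (y ∷_) σ∈
  rewrite ≢⇒≡ᵇ-false y x (x∉ ∘ here ∘ sym) =
  cong (y ∷_) (removeFirst-insertions x ys (x∉ ∘ there) σ′∈)

Unique-insertions : ∀ x π → x ∉ π → Unique (insertions x π)
Unique-insertions x []       x∉ = [] ∷ []
Unique-insertions x (y ∷ ys) x∉ =
  All.tabulate head∉ ∷ Unique.map⁺ ∷-injectiveʳ (Unique-insertions x ys (x∉ ∘ there))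
  where
  head∉ : ∀ {σ} → σ ∈ map (y ∷_) (insertions x ys) → x ∷ y ∷ ys ≢ σ
  head∉ σ∈ eq with σ′ , σ′∈ , refl ← ∈-map⁻ (y ∷_) σ∈ = x∉ (here (proj₁ (∷-injective eq)))

Unique-S : ∀ n → Unique (S n)
Unique-S zero    = [] ∷ []
Unique-S (suc n) = Unique-concatMap⁺ (insertions (suc n)) (removeFirst (suc n)) (Unique-S n)
  (λ π∈ → Unique-insertions _ _ (1+n∉ π∈)) (λ π∈ σ∈ → removeFirst-insertions _ _ (1+n∉ π∈) σ∈)
  where
  1+n∉ : ∀ {π} → π ∈ S n → suc n ∉ π
  1+n∉ π∈ 1+n∈ = n≮n n (proj₂ (↭descending⇒bounds n (∈S⇒↭ n π∈) 1+n∈))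

adjKinds-map-∷ : ∀ p y (σs : List (List ℕ)) → map (adjKinds p) (map (y ∷_) σs) ≡ map (adjKind p y ∷_) (map (adjKinds y) σs)
adjKinds-map-∷ p y σs = trans (sym (map-∘ σs)) (map-∘ σs)

-- Insert n + 1 into a word σ with letters in [n], preceded by the letter p.  Directly after n
-- it adds a left succession (n a was a descent, and so is n+1 a); inside any other pair it
-- replaces that pair by a jump followed by a descent; at the end it adds a jump, which accounts
-- for splitting the descent that follows n.
module AdjacentInsertion (n : ℕ) where

  InsertionLaw : ℕ → List ℕ → Set
  InsertionLaw p σ = map tally (map (adjKinds p) (insertions (suc n) σ))
                   ↭ bump L (tally (adjKinds p σ)) ∷ map tally (splits (adjKinds p σ))

  insertions-below : ∀ p σ → p < n → All (_< n) σ →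
    map (adjKinds p) (insertions (suc n) σ) ≡ splits (adjKinds p σ) ++ (adjKinds p σ ∷ʳ J) ∷ []
  insertions-below p []      p<n []           = cong (λ k → (k ∷ []) ∷ []) (adjKind-J p (suc n) (s≤s p<n))
  insertions-below p (y ∷ σ) p<n (y<n ∷ σ<n) =
    cong₂ _∷_ (cong₂ (λ k k′ → k ∷ k′ ∷ adjKinds y σ) (adjKind-J p (suc n) (s≤s p<n)) (adjKind-D (suc n) y (m≤n⇒m≤1+n (<⇒≤ y<n))))
      (trans (adjKinds-map-∷ p y _)
      (trans (cong (map (adjKind p y ∷_)) (insertions-below y σ y<n σ<n))
             (map-++ _ (splits (adjKinds y σ)) _)))

  insertionLaw-∷ : ∀ p y σ → p < n → y ≤ n → InsertionLaw y σ → InsertionLaw p (y ∷ σ)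
  insertionLaw-∷ p y σ p<n y≤n law = begin
    map tally (map (adjKinds p) (insertions (suc n) (y ∷ σ)))
      ≡⟨ cong₂ _∷_ (cong₂ (λ k k′ → bump k (bump k′ t)) (adjKind-J p (suc n) (s≤s p<n)) (adjKind-D (suc n) y (m≤n⇒m≤1+n y≤n)))
                   (trans (cong (map tally) (adjKinds-map-∷ p y _)) (map-tally-∷ k (map (adjKinds y) (insertions (suc n) σ)))) ⟩
    bump J (bump D t) ∷ map (bump k) (map tally (map (adjKinds y) (insertions (suc n) σ)))
      ↭⟨ prep _ (map⁺ (bump k) law) ⟩
    bump J (bump D t) ∷ bump k (bump L t) ∷ map (bump k) (map tally (splits ks))
      ↭⟨ swap _ _ ↭-refl ⟩
    bump k (bump L t) ∷ bump J (bump D t) ∷ map (bump k) (map tally (splits ks))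
      ≡⟨ cong₂ _∷_ (bump-comm k L t) (cong (_ ∷_) (sym (map-tally-∷ k (splits ks)))) ⟩
    bump L (tally (adjKinds p (y ∷ σ))) ∷ map tally (splits (adjKinds p (y ∷ σ))) ∎
    where
    open PermutationReasoning
    k  = adjKind p y
    ks = adjKinds y σ
    t  = tally ks

  insertionLaw-after-n : ∀ σ → All (_< n) σ → InsertionLaw n σ
  insertionLaw-after-n []      []           = ↭-reflexive (cong (λ k → bump k (0 , 0 , 0) ∷ []) (adjKind-L n))
  insertionLaw-after-n (y ∷ σ) (y<n ∷ σ<n) = begin
    map tally (map (adjKinds n) (insertions (suc n) (y ∷ σ)))
      ≡⟨ cong₂ _∷_ (cong₂ (λ k k′ → bump k (bump k′ t)) (adjKind-L n) (adjKind-D (suc n) y (m≤n⇒m≤1+n (<⇒≤ y<n))))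
                   (cong (map tally) later) ⟩
    bump L (bump D t) ∷ map tally (map (D ∷_) (splits ks ++ (ks ∷ʳ J) ∷ []))
      ≡⟨ cong (bump L (bump D t) ∷_) (trans (cong (map tally) (map-++ (D ∷_) (splits ks) _)) (map-++ tally (map (D ∷_) (splits ks)) _)) ⟩
    bump L (bump D t) ∷ map tally (map (D ∷_) (splits ks)) ++ tally (D ∷ ks ∷ʳ J) ∷ []
      ↭⟨ prep _ (↭-sym (∷↭∷ʳ _ _)) ⟩
    bump L (bump D t) ∷ tally (D ∷ ks ∷ʳ J) ∷ map tally (map (D ∷_) (splits ks))
      ≡⟨ cong (λ u → bump L (bump D t) ∷ u ∷ map tally (map (D ∷_) (splits ks))) (trans (cong (bump D) (tally-∷ʳ ks J)) (bump-comm D J t)) ⟩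
    bump L (bump D t) ∷ bump J (bump D t) ∷ map tally (map (D ∷_) (splits ks))
      ≡⟨ cong (λ k → bump L (bump k t) ∷ bump J (bump D t) ∷ map tally (map (k ∷_) (splits ks))) (sym y-descent) ⟩
    bump L (tally (adjKinds n (y ∷ σ))) ∷ map tally (splits (adjKinds n (y ∷ σ))) ∎
    where
    open PermutationReasoning
    ks = adjKinds y σ
    t  = tally ks
    y-descent : adjKind n y ≡ D
    y-descent = adjKind-D n y (<⇒≤ y<n)
    later : map (adjKinds n) (map (y ∷_) (insertions (suc n) σ)) ≡ map (D ∷_) (splits ks ++ (ks ∷ʳ J) ∷ [])
    later = trans (adjKinds-map-∷ n y _) (cong₂ (λ k kss → map (k ∷_) kss) y-descent (insertions-below y σ y<n σ<n))

  insertionLaw : ∀ p σ → p < n → All (_≤ n) σ → n ∈ σ → Unique σ → InsertionLaw p σ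
  insertionLaw p (y ∷ σ) p<n (y≤n ∷ σ≤n) n∈ (y∉ ∷ u) with y ≟ n
  ... | yes refl = insertionLaw-∷ p y σ p<n y≤n (insertionLaw-after-n σ (All.zipWith below (σ≤n , y∉)))
    where below : ∀ {a} → a ≤ y × y ≢ a → a < y
          below (a≤y , y≢a) = ≤∧≢⇒< a≤y (≢-sym y≢a)
  ... | no y≢n with n∈
  ...   | here n≡y = ⊥-elim (y≢n (sym n≡y))
  ...   | there n∈σ = insertionLaw-∷ p y σ p<n y≤n (insertionLaw y σ (≤∧≢⇒< y≤n y≢n) σ≤n n∈σ u)

insertionLaw-0 : ∀ n {σ} → σ ↭ descending n → AdjacentInsertion.InsertionLaw n 0 σ
insertionLaw-0 zero    σ↭ with refl ← ↭-empty-inv σ↭ = AdjacentInsertion.insertionLaw-after-n 0 [] []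
insertionLaw-0 (suc n) {σ} σ↭ = AdjacentInsertion.insertionLaw (suc n) 0 σ (s≤s z≤n)
  (All.tabulate (proj₂ ∘ ↭descending⇒bounds (suc n) σ↭))
  (∈-resp-↭ (↭-sym σ↭) (here refl))
  (Unique-resp-↭ (↭-sym σ↭) (Unique-descending (suc n)))

jdl-insertions : ∀ n {σ} → σ ∈ S n → map jdl (insertions (suc n) σ) ↭ children (jdl σ)
jdl-insertions n {σ} σ∈ = begin
  map jdl (insertions (suc n) σ)                                ≡⟨ map-cong-local (All.tabulate λ τ∈ → jdl-tally _ (inserted-Unique τ∈)) ⟩
  map (tally ∘ adjKinds 0) (insertions (suc n) σ)               ≡⟨ map-∘ (insertions (suc n) σ) ⟩
  map tally (map (adjKinds 0) (insertions (suc n) σ))           ↭⟨ insertionLaw-0 n σ↭ ⟩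
  bump L (tally (adjKinds 0 σ)) ∷ map tally (splits (adjKinds 0 σ)) ↭⟨ prep _ (tally-splits (adjKinds 0 σ)) ⟩
  children (tally (adjKinds 0 σ))                               ≡⟨ cong children (jdl-tally σ (↭descending⇒Unique-0∷ n σ↭)) ⟨
  children (jdl σ)                                              ∎
  where
  open PermutationReasoning
  σ↭ : σ ↭ descending n
  σ↭ = ∈S⇒↭ n σ∈
  inserted-Unique : ∀ {τ} → τ ∈ insertions (suc n) σ → Unique (0 ∷ τ)
  inserted-Unique τ∈ = ↭descending⇒Unique-0∷ (suc n) (↭-trans (insertions-↭ (suc n) σ τ∈) (prep (suc n) σ↭))

insertNth : {A : Set} → ℕ → A → List A → List A
insertNth zero    a xs       = a ∷ xs
insertNth (suc k) a []       = a ∷ []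
insertNth (suc k) a (x ∷ xs) = x ∷ insertNth k a xs

-- Out of range the value 0 is junk; nth is only used below the length.
nth : ℕ → List ℕ → ℕ
nth k       []       = 0
nth zero    (x ∷ xs) = x
nth (suc k) (x ∷ xs) = nth k xs

length-∷ʳ : {A : Set} (xs : List A) (x : A) → length (xs ∷ʳ x) ≡ suc (length xs)
length-∷ʳ []       x = refl
length-∷ʳ (y ∷ xs) x = cong suc (length-∷ʳ xs x)

length-insertNth : {A : Set} (k : ℕ) (a : A) (xs : List A) → length (insertNth k a xs) ≡ suc (length xs)
length-insertNth zero    a xs       = refl
length-insertNth (suc k) a []       = refl
length-insertNth (suc k) a (x ∷ xs) = cong suc (length-insertNth k a xs)

insertNth-↭ : {A : Set} (k : ℕ) (a : A) (xs : List A) → insertNth k a xs ↭ a ∷ xs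
insertNth-↭ zero    a xs       = ↭-refl
insertNth-↭ (suc k) a []       = ↭-refl
insertNth-↭ (suc k) a (x ∷ xs) = ↭-trans (prep x (insertNth-↭ k a xs)) (swap x a ↭-refl)

insertNth-∷ʳ : {A : Set} (k : ℕ) (a : A) (xs : List A) (l : A) → k ≤ length xs → insertNth k a (xs ∷ʳ l) ≡ insertNth k a xs ∷ʳ l
insertNth-∷ʳ zero    a xs       l _         = refl
insertNth-∷ʳ (suc k) a (x ∷ xs) l (s≤s k≤) = cong (x ∷_) (insertNth-∷ʳ k a xs l k≤)

deleteNth-insertNth : {A : Set} (k : ℕ) (a : A) (xs : List A) → k ≤ length xs → deleteNth k (insertNth k a xs) ≡ xs
deleteNth-insertNth zero    a xs       _         = refl
deleteNth-insertNth (suc k) a (x ∷ xs) (s≤s k≤) = cong (x ∷_) (deleteNth-insertNth k a xs k≤)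

nth-insertNth : ∀ k a xs → k ≤ length xs → nth k (insertNth k a xs) ≡ a
nth-insertNth zero    a xs       _         = refl
nth-insertNth (suc k) a (x ∷ xs) (s≤s k≤) = nth-insertNth k a xs k≤

insertNth-deleteNth : ∀ k xs → k < length xs → insertNth k (nth k xs) (deleteNth k xs) ≡ xs
insertNth-deleteNth zero    (x ∷ xs) _         = refl
insertNth-deleteNth (suc k) (x ∷ xs) (s≤s k<) = cong (x ∷_) (insertNth-deleteNth k xs k<)

insertions-insertNth : ∀ x σ → insertions x σ ≡ map (λ k → insertNth k x σ) (upTo (length σ)) ++ (σ ∷ʳ x) ∷ []
insertions-insertNth x []      = refl
insertions-insertNth x (y ∷ σ) = cong ((x ∷ y ∷ σ) ∷_) (begin
  map (y ∷_) (insertions x σ)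
    ≡⟨ cong (map (y ∷_)) (insertions-insertNth x σ) ⟩
  map (y ∷_) (map (λ k → insertNth k x σ) (upTo (length σ)) ++ (σ ∷ʳ x) ∷ [])
    ≡⟨ map-++ (y ∷_) (map (λ k → insertNth k x σ) (upTo (length σ))) _ ⟩
  map (y ∷_) (map (λ k → insertNth k x σ) (upTo (length σ))) ++ (y ∷ σ ∷ʳ x) ∷ []
    ≡⟨ cong (_++ (y ∷ σ ∷ʳ x) ∷ []) (trans (sym (map-∘ (upTo (length σ)))) (map-applyUpTo _ _ (length σ))) ⟩
  applyUpTo (λ k → insertNth (suc k) x (y ∷ σ)) (length σ) ++ (y ∷ σ ∷ʳ x) ∷ []
    ≡⟨ cong (_++ (y ∷ σ ∷ʳ x) ∷ []) (map-applyUpTo suc _ (length σ)) ⟨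
  map (λ k → insertNth k x (y ∷ σ)) (applyUpTo suc (length σ)) ++ (y ∷ σ ∷ʳ x) ∷ [] ∎)
  where open ≡-Reasoning

initial : List ℕ → List ℕ
initial []          = []
initial (a ∷ [])    = []
initial (a ∷ b ∷ σ) = a ∷ initial (b ∷ σ)

final : List ℕ → ℕ
final []          = 0
final (a ∷ [])    = a
final (a ∷ b ∷ σ) = final (b ∷ σ)

initial-∷ʳ : ∀ π l → initial (π ∷ʳ l) ≡ π
initial-∷ʳ []          l = refl
initial-∷ʳ (a ∷ [])    l = refl
initial-∷ʳ (a ∷ b ∷ π) l = cong (a ∷_) (initial-∷ʳ (b ∷ π) l)

final-∷ʳ : ∀ π l → final (π ∷ʳ l) ≡ l
final-∷ʳ []          l = refl
final-∷ʳ (a ∷ [])    l = refl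
final-∷ʳ (a ∷ b ∷ π) l = final-∷ʳ (b ∷ π) l

rotate : ℕ → List ℕ → List ℕ
rotate k σ = insertNth k (final σ) (initial σ)

unrotate : ℕ → List ℕ → List ℕ
unrotate k τ = deleteNth k τ ∷ʳ nth k τ

rotate-∷ʳ : ∀ k π l → rotate k (π ∷ʳ l) ≡ insertNth k l π
rotate-∷ʳ k π l = cong₂ (insertNth k) (final-∷ʳ π l) (initial-∷ʳ π l)

unrotate-rotate : ∀ k σ → k < length σ → unrotate k (rotate k σ) ≡ σ
unrotate-rotate k σ k< with initLast σ
... | π ∷ʳ′ l rewrite rotate-∷ʳ k π l | length-∷ʳ π l =
  cong₂ _∷ʳ_ (deleteNth-insertNth k l π (≤-pred k<)) (nth-insertNth k l π (≤-pred k<))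

rotate-unrotate : ∀ k τ → k < length τ → rotate k (unrotate k τ) ≡ τ
rotate-unrotate k τ k< = trans (rotate-∷ʳ k (deleteNth k τ) (nth k τ)) (insertNth-deleteNth k τ k<)

rotate-↭ : ∀ k σ → 0 < length σ → rotate k σ ↭ σ
rotate-↭ k σ 0< with initLast σ
... | π ∷ʳ′ l rewrite rotate-∷ʳ k π l = ↭-trans (insertNth-↭ k l π) (∷↭∷ʳ l π)

unrotate-↭ : ∀ k τ → k < length τ → unrotate k τ ↭ τ
unrotate-↭ k τ k< = begin
  deleteNth k τ ∷ʳ nth k τ                     ↭⟨ ∷↭∷ʳ (nth k τ) (deleteNth k τ) ⟨
  nth k τ ∷ deleteNth k τ                      ↭⟨ insertNth-↭ k (nth k τ) (deleteNth k τ) ⟨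
  insertNth k (nth k τ) (deleteNth k τ)        ≡⟨ insertNth-deleteNth k τ k< ⟩
  τ                                            ∎
  where open PermutationReasoning

rotate-S : ∀ n k → k < n → map (rotate k) (S n) ↭ S n
rotate-S n k k<n = map-↭-bijection (rotate k) (unrotate k) (S n) (Unique-S n)
  (λ σ∈ → ↭⇒∈S n (↭-trans (rotate-↭ k _ (≤-trans (s≤s z≤n) (k<length σ∈))) (∈S⇒↭ n σ∈)))
  (λ σ∈ → ↭⇒∈S n (↭-trans (unrotate-↭ k _ (k<length σ∈)) (∈S⇒↭ n σ∈)))
  (λ σ∈ → unrotate-rotate k _ (k<length σ∈))
  (λ σ∈ → rotate-unrotate k _ (k<length σ∈))
  where
  k<length : ∀ {σ} → σ ∈ S n → k < length σ
  k<length σ∈ = subst (k <_) (sym (length-S n σ∈)) k<n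

length-posKinds : ∀ i σ → length (posKinds i σ) ≡ length σ
length-posKinds i []      = refl
length-posKinds i (a ∷ σ) = cong suc (length-posKinds (suc i) σ)

posKinds-∷ʳ : ∀ i σ l → posKinds i (σ ∷ʳ l) ≡ posKinds i σ ∷ʳ posKind (i + length σ) l
posKinds-∷ʳ i []      l = cong (λ j → posKind j l ∷ []) (sym (+-identityʳ i))
posKinds-∷ʳ i (a ∷ σ) l = cong (posKind i a ∷_)
  (trans (posKinds-∷ʳ (suc i) σ l) (cong (λ j → posKinds (suc i) σ ∷ʳ posKind j l) (sym (+-suc i (length σ)))))

posKinds-insertNth-↭ : ∀ i k a π → k ≤ length π →
  posKinds i (insertNth k a π) ↭ posKind (i + k) a ∷ deleteNth k (posKinds i (insertNth k a π))
posKinds-insertNth-↭ i zero    a π       _         = ↭-reflexive (cong (λ j → posKind j a ∷ posKinds (suc i) π) (sym (+-identityʳ i)))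
posKinds-insertNth-↭ i (suc k) a (y ∷ π) (s≤s k≤) =
  ↭-trans (prep (posKind i y) (posKinds-insertNth-↭ (suc i) k a π k≤))
  (↭-trans (swap _ _ ↭-refl)
  (↭-reflexive (cong (λ j → posKind j a ∷ posKind i y ∷ deleteNth k (posKinds (suc i) (insertNth k a π))) (sym (+-suc i k)))))

deleteNth-posKinds-insertNth : ∀ i k a b π → k ≤ length π →
  deleteNth k (posKinds i (insertNth k a π)) ≡ deleteNth k (posKinds i (insertNth k b π))
deleteNth-posKinds-insertNth i zero    a b π       _         = refl
deleteNth-posKinds-insertNth i (suc k) a b (y ∷ π) (s≤s k≤) = cong (posKind i y ∷_) (deleteNth-posKinds-insertNth (suc i) k a b π k≤)

-- For σ = π l, inserting n + 1 at index k is the cycle insertion into τ = rotate k σ (that is,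
-- π with l inserted at index k) putting n + 1 at position k + 1 and l at position n + 1:
-- position k + 1 becomes an excedance, position n + 1 a drop, and no other position changes.
module CycleInsertion (n : ℕ) where

  edf-insertNth-∷ʳ : ∀ k π l → k < n → suc (length π) ≡ n → l ≤ n →
    edf (insertNth k (suc n) (π ∷ʳ l)) ≡ splitTally k (posKinds 1 (insertNth k l π))
  edf-insertNth-∷ʳ k π l k<n 1+π≡n l≤n = begin
    edf (insertNth k (suc n) (π ∷ʳ l))
      ≡⟨ edf-tally (insertNth k (suc n) (π ∷ʳ l)) ⟩
    tally (posKinds 1 (insertNth k (suc n) (π ∷ʳ l)))
      ≡⟨ cong (tally ∘ posKinds 1) (insertNth-∷ʳ k (suc n) π l k≤π) ⟩
    tally (posKinds 1 (τ ∷ʳ l))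
      ≡⟨ cong tally (posKinds-∷ʳ 1 τ l) ⟩
    tally (posKinds 1 τ ∷ʳ posKind (suc (length τ)) l)
      ≡⟨ tally-∷ʳ (posKinds 1 τ) _ ⟩
    bump (posKind (suc (length τ)) l) (tally (posKinds 1 τ))
      ≡⟨ cong₂ bump (posKind-D _ l l<) (tally-↭ (posKinds-insertNth-↭ 1 k (suc n) π k≤π)) ⟩
    bump D (bump (posKind (suc k) (suc n)) (tally (deleteNth k (posKinds 1 τ))))
      ≡⟨ cong₂ (λ x ks → bump D (bump x (tally ks))) (posKind-J (suc k) (suc n) (s≤s k<n))
                                                     (deleteNth-posKinds-insertNth 1 k (suc n) l π k≤π) ⟩
    bump D (bump J (tally (deleteNth k (posKinds 1 (insertNth k l π)))))
      ≡⟨ bump-comm D J _ ⟩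
    splitTally k (posKinds 1 (insertNth k l π)) ∎
    where
    open ≡-Reasoning
    τ = insertNth k (suc n) π
    k≤π : k ≤ length π
    k≤π = ≤-pred (subst (k <_) (sym 1+π≡n) k<n)
    l< : l < suc (length τ)
    l< = subst (l <_) (cong suc (sym (trans (length-insertNth k (suc n) π) 1+π≡n))) (s≤s l≤n)

  edf-insertNth : ∀ k {σ} → k < n → σ ∈ S n → edf (insertNth k (suc n) σ) ≡ splitTally k (posKinds 1 (rotate k σ))
  edf-insertNth k {σ} k<n σ∈ with initLast σ
  ... | [] = ⊥-elim (n≮n 0 (≤-trans (s≤s z≤n) (subst (k <_) (sym (length-S n σ∈)) k<n)))
  ... | π ∷ʳ′ l = trans (edf-insertNth-∷ʳ k π l k<n (trans (sym (length-∷ʳ π l)) (length-S n σ∈)) l≤n)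
                        (cong (splitTally k ∘ posKinds 1) (sym (rotate-∷ʳ k π l)))
    where
    l≤n : l ≤ n
    l≤n = proj₂ (↭descending⇒bounds n (∈S⇒↭ n σ∈) (∈-resp-↭ (∷↭∷ʳ l π) (here refl)))

  edf-∷ʳ-fixed : ∀ {τ} → τ ∈ S n → edf (τ ∷ʳ suc n) ≡ bump L (tally (posKinds 1 τ))
  edf-∷ʳ-fixed {τ} τ∈ = begin
    edf (τ ∷ʳ suc n)                                                ≡⟨ edf-tally (τ ∷ʳ suc n) ⟩
    tally (posKinds 1 (τ ∷ʳ suc n))                                 ≡⟨ cong tally (posKinds-∷ʳ 1 τ (suc n)) ⟩
    tally (posKinds 1 τ ∷ʳ posKind (suc (length τ)) (suc n))        ≡⟨ tally-∷ʳ (posKinds 1 τ) _ ⟩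
    bump (posKind (suc (length τ)) (suc n)) (tally (posKinds 1 τ))  ≡⟨ cong (λ m → bump (posKind (suc m) (suc n)) _) (length-S n τ∈) ⟩
    bump (posKind (suc n) (suc n)) (tally (posKinds 1 τ))           ≡⟨ cong (λ x → bump x _) (posKind-L (suc n)) ⟩
    bump L (tally (posKinds 1 τ))                                   ∎
    where open ≡-Reasoning

  children-edf : ∀ {τ} → τ ∈ S n →
    map (λ k → splitTally k (posKinds 1 τ)) (upTo n) ++ edf (τ ∷ʳ suc n) ∷ [] ↭ children (edf τ)
  children-edf {τ} τ∈ = begin
    map (λ k → splitTally k ks) (upTo n) ++ edf (τ ∷ʳ suc n) ∷ []
      ≡⟨ cong₂ (λ m t → map (λ k → splitTally k ks) (upTo m) ++ t ∷ []) (sym length-ks) (edf-∷ʳ-fixed τ∈) ⟩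
    map (λ k → splitTally k ks) (upTo (length ks)) ++ bump L (tally ks) ∷ []
      ≡⟨ cong (_++ bump L (tally ks) ∷ []) (map-tally-splits ks) ⟨
    map tally (splits ks) ++ bump L (tally ks) ∷ []
      ↭⟨ ∷↭∷ʳ _ _ ⟨
    bump L (tally ks) ∷ map tally (splits ks)
      ↭⟨ prep _ (tally-splits ks) ⟩
    children (tally ks)
      ≡⟨ cong children (edf-tally τ) ⟨
    children (edf τ) ∎
    where
    open PermutationReasoning
    ks = posKinds 1 τ
    length-ks : length ks ≡ n
    length-ks = trans (length-posKinds 1 τ) (length-S n τ∈)

  insertNth-S-↭ : ∀ k → k < n →
    map (λ σ → edf (insertNth k (suc n) σ)) (S n) ↭ map (λ τ → splitTally k (posKinds 1 τ)) (S n)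
  insertNth-S-↭ k k<n = begin
    map (λ σ → edf (insertNth k (suc n) σ)) (S n)  ≡⟨ map-cong-local (All.tabulate (edf-insertNth k k<n)) ⟩
    map (G ∘ rotate k) (S n)                       ≡⟨ map-∘ (S n) ⟩
    map G (map (rotate k) (S n))                   ↭⟨ map⁺ G (rotate-S n k k<n) ⟩
    map G (S n)                                    ∎
    where
    open PermutationReasoning
    G : List ℕ → Triple
    G τ = splitTally k (posKinds 1 τ)

  map-edf-insertions : ∀ {σ} → σ ∈ S n → map edf (insertions (suc n) σ) ≡
    map (λ k → edf (insertNth k (suc n) σ)) (upTo n) ++ edf (σ ∷ʳ suc n) ∷ []
  map-edf-insertions {σ} σ∈ = begin
    map edf (insertions (suc n) σ)
      ≡⟨ cong (map edf) (insertions-insertNth (suc n) σ) ⟩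
    map edf (map (λ k → insertNth k (suc n) σ) (upTo (length σ)) ++ (σ ∷ʳ suc n) ∷ [])
      ≡⟨ map-++ edf (map (λ k → insertNth k (suc n) σ) (upTo (length σ))) _ ⟩
    map edf (map (λ k → insertNth k (suc n) σ) (upTo (length σ))) ++ edf (σ ∷ʳ suc n) ∷ []
      ≡⟨ cong (_++ edf (σ ∷ʳ suc n) ∷ []) (map-∘ (upTo (length σ))) ⟨
    map (λ k → edf (insertNth k (suc n) σ)) (upTo (length σ)) ++ edf (σ ∷ʳ suc n) ∷ []
      ≡⟨ cong (λ m → map (λ k → edf (insertNth k (suc n) σ)) (upTo m) ++ edf (σ ∷ʳ suc n) ∷ []) (length-S n σ∈) ⟩
    map (λ k → edf (insertNth k (suc n) σ)) (upTo n) ++ edf (σ ∷ʳ suc n) ∷ [] ∎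
    where open ≡-Reasoning

  map-edf-S : map edf (S (suc n)) ↭ concatMap (children ∘ edf) (S n)
  map-edf-S = begin
    map edf (S (suc n))
      ≡⟨ map-concatMap edf (insertions (suc n)) (S n) ⟩
    concatMap (map edf ∘ insertions (suc n)) (S n)
      ≡⟨ cong concat (map-cong-local (All.tabulate map-edf-insertions)) ⟩
    concatMap (λ σ → map (λ k → F k σ) (upTo n) ++ fixed σ) (S n)
      ↭⟨ concatMap-++-↭ _ fixed (S n) ⟩
    concatMap (λ σ → map (λ k → F k σ) (upTo n)) (S n) ++ concatMap fixed (S n)
      ↭⟨ ++⁺ʳ _ (concatMap-map-comm (λ σ k → F k σ) (S n) (upTo n)) ⟩
    concatMap (λ k → map (F k) (S n)) (upTo n) ++ concatMap fixed (S n)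
      ↭⟨ ++⁺ʳ _ (concatMap-cong-↭ (upTo n) (insertNth-S-↭ _ ∘ ∈-upTo⁻)) ⟩
    concatMap (λ k → map (λ τ → G k τ) (S n)) (upTo n) ++ concatMap fixed (S n)
      ↭⟨ ++⁺ʳ _ (concatMap-map-comm (λ τ k → G k τ) (S n) (upTo n)) ⟨
    concatMap (λ τ → map (λ k → G k τ) (upTo n)) (S n) ++ concatMap fixed (S n)
      ↭⟨ concatMap-++-↭ _ fixed (S n) ⟨
    concatMap (λ τ → map (λ k → G k τ) (upTo n) ++ fixed τ) (S n)
      ↭⟨ concatMap-cong-↭ (S n) children-edf ⟩
    concatMap (children ∘ edf) (S n) ∎
    where
    open PermutationReasoning
    F : ℕ → List ℕ → Triple
    F k σ = edf (insertNth k (suc n) σ)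
    G : ℕ → List ℕ → Triple
    G k τ = splitTally k (posKinds 1 τ)
    fixed : List ℕ → List Triple
    fixed σ = edf (σ ∷ʳ suc n) ∷ []

map-jdl-S : ∀ n → map jdl (S (suc n)) ↭ concatMap (children ∘ jdl) (S n)
map-jdl-S n = begin
  map jdl (S (suc n))                              ≡⟨ map-concatMap jdl (insertions (suc n)) (S n) ⟩
  concatMap (map jdl ∘ insertions (suc n)) (S n)   ↭⟨ concatMap-cong-↭ (S n) (jdl-insertions n) ⟩
  concatMap (children ∘ jdl) (S n)                 ∎
  where open PermutationReasoning

map-jdl-S↭map-edf-S : ∀ n → map jdl (S n) ↭ map edf (S n)
map-jdl-S↭map-edf-S zero    = ↭-refl
map-jdl-S↭map-edf-S (suc n) = begin
  map jdl (S (suc n))                     ↭⟨ map-jdl-S n ⟩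
  concatMap (children ∘ jdl) (S n)        ≡⟨ concatMap-map children jdl (S n) ⟨
  concatMap children (map jdl (S n))      ↭⟨ concatMap⁺ children (map-jdl-S↭map-edf-S n) ⟩
  concatMap children (map edf (S n))      ≡⟨ concatMap-map children edf (S n) ⟩
  concatMap (children ∘ edf) (S n)        ↭⟨ CycleInsertion.map-edf-S n ⟨
  map edf (S (suc n))                     ∎
  where open PermutationReasoning

coeff-map : ∀ st n t → coeff st n t ≡ length (filter (λ u → T? (u ≡³ t)) (map st (S n)))
coeff-map st n t = count (S n)
  where
  count : ∀ σs → length (filter (λ σ → T? (st σ ≡³ t)) σs) ≡ length (filter (λ u → T? (u ≡³ t)) (map st σs))
  count []       = refl
  count (σ ∷ σs) with st σ ≡³ t
  ... | true  = cong suc (count σs)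
  ... | false = count σs

theorem3p5 : (n : ℕ) → 1 ≤ n → (a b c : ℕ) →
    coeff jdl n (a , b , c) ≡ coeff edf n (a , b , c)
theorem3p5 n _ a b c = begin
  coeff jdl n (a , b , c)                                      ≡⟨ coeff-map jdl n (a , b , c) ⟩
  length (filter (λ u → T? (u ≡³ (a , b , c))) (map jdl (S n))) ≡⟨ ↭-length (filter-↭ _ (map-jdl-S↭map-edf-S n)) ⟩
  length (filter (λ u → T? (u ≡³ (a , b , c))) (map edf (S n))) ≡⟨ coeff-map edf n (a , b , c) ⟨
  coeff edf n (a , b , c)                                      ∎
  where open ≡-Reasoning
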